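{- Let $H$ be a bipartite graph and $k\geq 3$ an integer. If $H$ is connected or $k\geq \frac{t(H)-1}{s(H)-1}$, then $h_k(H,P_4)=\max\{BR_2(H),\,k(s(H)-1)+1\}$.
   Context: $P_4$ is the path on $4$ vertices. For a bipartite graph $H$, consider all bipartitions $(S,T)$ of $V(H)$ into two independent sets with $|S|\leq|T|$; $s(H)$ is the minimum of $|S|$ and $t(H)$ is the maximum of $|T|$ over all such bipartitions. Monochromatic: all edges same color; rainbow: all edges distinct colors. The $k$-colored bipartite Ramsey number $BR_k(H)$ is the minimum $n$ such that every coloring of the edges of $K_{n,n}$ with colors from $\{1,\dots,k\}$ contains a monochromatic copy of $H$. For bipartite graphs $H,G$ and a positive integer $k$, $h_k(H,G)$ is the minimum $n$ such that every edge-coloring of $K_{n,n}$ using at most $k$ colors contains a monochromatic copy of $H$ or a rainbow copy of $G$. -}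

module Defs where

open import Data.Nat using (ℕ; zero; suc; _+_; _*_; _∸_; _≤_)
open import Data.Nat.Properties using (suc-injective)
open import Data.Fin using (Fin; toℕ)
open import Data.Fin.Subset using (Subset; ∣_∣; ∁)
open import Data.Vec using (lookup)
open import Data.Bool using (Bool)
open import Data.Maybe using (Maybe; just; nothing)
open import Data.Sum using (_⊎_; inj₁; inj₂)
open import Data.Product using (Σ; ∃; _×_; _,_)
open import Data.Empty using (⊥)
open import Relation.Nullary using (¬_)
open import Relation.Binary.PropositionalEquality using (_≡_; _≢_; refl)
open import Function.Definitions using (Injective)

record Graph : Set₁ where
  field
    size  : ℕ
    E     : Fin size → Fin size → Set
    E-sym : ∀ {u v} → E u v → E v u
    E-irrefl : ∀ {u} → ¬ E u u
open Graph public

HasEdge : Graph → Set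
HasEdge H = Σ (Fin (size H)) λ u → Σ (Fin (size H)) λ v → E H u v

data Reach (H : Graph) : Fin (size H) → Fin (size H) → Set where
  here : ∀ {u} → Reach H u u
  step : ∀ {u v w} → E H u v → Reach H v w → Reach H u w

Connected : Graph → Set
Connected H = ∀ u v → Reach H u v

-- A bipartition (S, T) of V(H) into two independent sets: S = p, T = ∁ p.
IsBipartition : (H : Graph) → Subset (size H) → Set
IsBipartition H p = ∀ {u v} → E H u v → lookup p u ≢ lookup p v

IsBipartite : Graph → Set
IsBipartite H = Σ (Subset (size H)) (IsBipartition H)

IsS : Graph → ℕ → Set
IsS H s =
  (Σ (Subset (size H)) λ p → IsBipartition H p × ∣ p ∣ ≤ ∣ ∁ p ∣ × ∣ p ∣ ≡ s)
  × (∀ p → IsBipartition H p → ∣ p ∣ ≤ ∣ ∁ p ∣ → s ≤ ∣ p ∣)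

IsT : Graph → ℕ → Set
IsT H t =
  (Σ (Subset (size H)) λ p → IsBipartition H p × ∣ p ∣ ≤ ∣ ∁ p ∣ × ∣ ∁ p ∣ ≡ t)
  × (∀ p → IsBipartition H p → ∣ p ∣ ≤ ∣ ∁ p ∣ → ∣ ∁ p ∣ ≤ t)

Least : (ℕ → Set) → ℕ → Set
Least P n = P n × (∀ m → P m → n ≤ m)

-- Vertices of K_{n,n}: inj₁ i (left part), inj₂ j (right part).
-- A k-edge-colouring of K_{n,n}: c i j is the colour of edge {inj₁ i, inj₂ j}.
Colouring : ℕ → ℕ → Set
Colouring n k = Fin n → Fin n → Fin k

edgeCol : ∀ {n k} → Colouring n k → Fin n ⊎ Fin n → Fin n ⊎ Fin n → Maybe (Fin k)
edgeCol c (inj₁ i) (inj₂ j) = just (c i j)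
edgeCol c (inj₂ j) (inj₁ i) = just (c i j)
edgeCol c (inj₁ _) (inj₁ _) = nothing
edgeCol c (inj₂ _) (inj₂ _) = nothing

IsCopy : ∀ {n k} (H : Graph) → Colouring n k → (Fin (size H) → Fin n ⊎ Fin n) → Set
IsCopy H c f = Injective _≡_ _≡_ f × (∀ {u v} → E H u v → edgeCol c (f u) (f v) ≢ nothing)

MonoCopy : ∀ {n k} → Graph → Colouring n k → Set
MonoCopy {n} {k} H c = Σ (Fin (size H) → Fin n ⊎ Fin n) λ f → IsCopy H c f ×
  Σ (Fin k) λ col → ∀ {u v} → E H u v → edgeCol c (f u) (f v) ≡ just col

RainbowCopy : ∀ {n k} → Graph → Colouring n k → Set
RainbowCopy {n} {k} G c = Σ (Fin (size G) → Fin n ⊎ Fin n) λ f → IsCopy G c f ×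
  (∀ {u v u' v'} → E G u v → E G u' v' →
     edgeCol c (f u) (f v) ≡ edgeCol c (f u') (f v') →
     (u ≡ u' × v ≡ v') ⊎ (u ≡ v' × v ≡ u'))

-- every k-colouring of K_{n,n} has a monochromatic H   (BR_k(H) is the least such n)
BRProp : ℕ → Graph → ℕ → Set
BRProp k H n = (c : Colouring n k) → MonoCopy H c

-- every k-colouring of K_{n,n} has a monochromatic H or a rainbow G  (h_k(H,G) is the least such n)
hProp : ℕ → Graph → Graph → ℕ → Set
hProp k H G n = (c : Colouring n k) → MonoCopy H c ⊎ RainbowCopy G c

P4E : Fin 4 → Fin 4 → Set
P4E u v = (suc (toℕ u) ≡ toℕ v) ⊎ (suc (toℕ v) ≡ toℕ u)

private
  noLoop : ∀ (n : ℕ) → suc n ≢ n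
  noLoop zero ()
  noLoop (suc n) e = noLoop n (suc-injective e)

  P4sym : ∀ {u v} → P4E u v → P4E v u
  P4sym (inj₁ e) = inj₂ e
  P4sym (inj₂ e) = inj₁ e

  P4irr : ∀ {u} → ¬ P4E u u
  P4irr {u} (inj₁ e) = noLoop (toℕ u) e
  P4irr {u} (inj₂ e) = noLoop (toℕ u) e

P4 : Graph
P4 = record { size = 4 ; E = P4E ; E-sym = P4sym ; E-irrefl = P4irr }

-- Colour each edge of K_{m,m} by its row, with at most s(H) − 1 rows of each
-- colour. A rainbow P4 is impossible, since one of its middle vertices is a row and both of its
-- edges there get that row's colour; a monochromatic H is impossible, since the vertices it sends
-- to rows of its colour would form a side of a bipartition with fewer than s(H) vertices. And a
-- 2-colouring read as a k-colouring has no rainbow P4, so h_k(H, P4) ≥ BR_2(H).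
--
-- In a k-colouring of K_{N,N} without rainbow P4, either every row is monochromatic,
-- or every column is, or only two colours occur. In the last case BR_2(H) ≤ N applies. In the first,
-- pigeonhole gives s(H) rows of one colour, into which the small side S of H is embedded, while
-- the large side T goes into the columns; this needs |T| ≤ N, which holds because t(H) ≤ k(s(H) − 1) + 1,
-- or, for connected H, because a copy of H in K_{BR_2,BR_2} puts all of T on one side.

{-# OPTIONS --safe #-}
module Submission where

open import Defs
open import Data.Nat using (ℕ; suc; _+_; _*_; _∸_; _≤_; _<_; z≤n; s≤s; _⊔_)
open import Data.Nat.Properties
  using (module ≤-Reasoning; ≤-trans; ≤-reflexive; ≤-<-trans; <⇒≤; _≤?_; _<?_; ≰⇒>; ≮⇒≥; <⇒≱; <-asym;
         ≤-pred; +-comm; +-monoʳ-≤; m≤n+m∸n; m≤m⊔n; m≤n⊔m; ⊔-lub)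
open import Data.Fin using (Fin; zero; suc; toℕ; fromℕ<; inject₁; inject≤; combine; remQuot; _≟_)
open import Data.Fin.Properties
  using (suc-injective; toℕ-injective; toℕ<n; toℕ-inject₁; inject₁-injective; inject≤-injective;
         combine-injectiveˡ; combine-injectiveʳ; combine-remQuot; injective⇒≤; any?; all?; ¬∀⟶∃¬)
open import Data.Fin.Patterns using (0F; 1F; 2F; 3F)
open import Data.Fin.Subset using (Subset; ∣_∣; ∁)
open import Data.Vec using ([]; _∷_; lookup; tabulate)
open import Data.Vec.Properties using (lookup-map; lookup∘tabulate; map-∘; map-cong; map-id)
open import Data.Bool using (Bool; true; false; not; _xor_; if_then_else_)
open import Data.Bool.Properties using (not-injective; not-involutive; ¬-not)
open import Data.Maybe using (Maybe; just; nothing)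
import Data.Maybe as Maybe
open import Data.Maybe.Properties using (just-injective; map-nothing)
open import Data.Sum using (_⊎_; inj₁; inj₂; [_,_]′; swap; reduce)
import Data.Sum as Sum
open import Data.Sum.Properties using (inj₁-injective; inj₂-injective; swap-involutive)
open import Data.Product using (Σ; ∃; ∃₂; _×_; _,_; proj₁; proj₂; uncurry)
open import Data.Product.Properties using (×-≡,≡→≡)
open import Data.Empty using (⊥; ⊥-elim)
open import Function using (_∘_; case_of_)
open import Function.Definitions using (Injective)
open import Relation.Nullary using (¬_; yes; no; does)
open import Relation.Nullary.Decidable using (¬?; _×-dec_; dec-true; dec-false; decidable-stable)
open import Relation.Binary.PropositionalEquality
  using (_≡_; _≢_; refl; sym; trans; cong; cong₂; subst; module ≡-Reasoning)

-- Subsets and fibres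

select : ∀ {n} (p : Subset n) → Fin ∣ p ∣ → Fin n
select (true ∷ p) zero = zero
select (true ∷ p) (suc i) = suc (select p i)
select (false ∷ p) i = suc (select p i)

select-member : ∀ {n} (p : Subset n) i → lookup p (select p i) ≡ true
select-member (true ∷ p) zero = refl
select-member (true ∷ p) (suc i) = select-member p i
select-member (false ∷ p) i = select-member p i

select-injective : ∀ {n} (p : Subset n) → Injective _≡_ _≡_ (select p)
select-injective (true ∷ p) {zero} {zero} _ = refl
select-injective (true ∷ p) {suc i} {suc j} e = cong suc (select-injective p (suc-injective e))
select-injective (false ∷ p) e = select-injective p (suc-injective e)

rank : ∀ {n} (p : Subset n) (u : Fin n) → lookup p u ≡ true → Fin ∣ p ∣
rank (true ∷ p) zero _ = zero
rank (true ∷ p) (suc u) e = suc (rank p u e)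
rank (false ∷ p) (suc u) e = rank p u e

rank-injective : ∀ {n} (p : Subset n) {u v eu ev} → rank p u eu ≡ rank p v ev → u ≡ v
rank-injective (true ∷ p) {zero} {zero} _ = refl
rank-injective (true ∷ p) {suc u} {suc v} e = cong suc (rank-injective p (suc-injective e))
rank-injective (false ∷ p) {suc u} {suc v} e = cong suc (rank-injective p e)

injection⇒∣p∣≤ : ∀ {n r} (p : Subset n) (h : ∀ u → lookup p u ≡ true → Fin r) →
  (∀ {u v} eu ev → h u eu ≡ h v ev → u ≡ v) → ∣ p ∣ ≤ r
injection⇒∣p∣≤ p h h-injective =
  injective⇒≤ {f = λ i → h (select p i) (select-member p i)} (select-injective p ∘ h-injective _ _)

lookup-∁ : ∀ {n} (p : Subset n) u → lookup (∁ p) u ≡ not (lookup p u)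
lookup-∁ p u = lookup-map u not p

∁-involutive : ∀ {n} (p : Subset n) → ∁ (∁ p) ≡ p
∁-involutive p = trans (sym (map-∘ not not p)) (trans (map-cong not-involutive p) (map-id p))

fibre : ∀ {n k} → (Fin n → Fin k) → Fin k → Subset n
fibre g γ = tabulate (λ i → does (g i ≟ γ))

∈fibre : ∀ {n k} (g : Fin n → Fin k) {γ i} → g i ≡ γ → lookup (fibre g γ) i ≡ true
∈fibre g {γ} {i} e = trans (lookup∘tabulate _ i) (dec-true (g i ≟ γ) e)

fibre-member : ∀ {n k} (g : Fin n → Fin k) {γ i} → lookup (fibre g γ) i ≡ true → g i ≡ γ
fibre-member g {γ} {i} e = decidable-stable (g i ≟ γ) λ g[i]≢γ →
  case trans (sym e) (trans (lookup∘tabulate _ i) (dec-false (g i ≟ γ) g[i]≢γ)) of λ ()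

fibres≤⇒≤ : ∀ {n k r} (g : Fin n → Fin k) → (∀ γ → ∣ fibre g γ ∣ ≤ r) → n ≤ k * r
fibres≤⇒≤ {n} {k} {r} g fibre≤ = injective⇒≤ {f = λ i → code (g i) i refl} (code-injective _ _)
  where
  code : ∀ γ i → g i ≡ γ → Fin (k * r)
  code γ i e = combine γ (inject≤ (rank (fibre g γ) i (∈fibre g e)) (fibre≤ γ))
  code-injective : ∀ {γ γ′ i i′} (e : g i ≡ γ) (e′ : g i′ ≡ γ′) → code γ i e ≡ code γ′ i′ e′ → i ≡ i′
  code-injective {γ} {γ′} e e′ eq with refl ← combine-injectiveˡ γ _ γ′ _ eq =
    rank-injective (fibre g γ) (inject≤-injective _ _ _ _ (combine-injectiveʳ γ _ γ _ eq))

pigeonhole-fibre : ∀ {n k} r (g : Fin n → Fin k) → k * r < n → ∃ λ γ → r < ∣ fibre g γ ∣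
pigeonhole-fibre r g k*r<n with any? (λ γ → r <? ∣ fibre g γ ∣)
... | yes found = found
... | no none = ⊥-elim (<⇒≱ k*r<n (fibres≤⇒≤ g (λ γ → ≮⇒≥ (λ r<γ → none (γ , r<γ)))))

balanced-colouring : ∀ {m k r} → m ≤ k * r → Σ (Fin m → Fin k) λ g → ∀ γ → ∣ fibre g γ ∣ ≤ r
balanced-colouring {m} {k} {r} m≤k*r =
  colour , λ γ → injection⇒∣p∣≤ (fibre colour γ) (λ i _ → proj₂ (split i)) (split-injective γ)
  where
  split : Fin m → Fin k × Fin r
  split i = remQuot r (inject≤ i m≤k*r)
  colour : Fin m → Fin k
  colour = proj₁ ∘ split
  split-injective : ∀ γ {i j} → lookup (fibre colour γ) i ≡ true → lookup (fibre colour γ) j ≡ true →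
    proj₂ (split i) ≡ proj₂ (split j) → i ≡ j
  split-injective γ {i} {j} ei ej eq = inject≤-injective _ _ i j (begin
    inject≤ i m≤k*r               ≡⟨ combine-remQuot {k} r (inject≤ i m≤k*r) ⟨
    uncurry combine (split i)     ≡⟨ cong (uncurry combine) same-split ⟩
    uncurry combine (split j)     ≡⟨ combine-remQuot {k} r (inject≤ j m≤k*r) ⟩
    inject≤ j m≤k*r               ∎)
    where
    open ≡-Reasoning
    same-split : split i ≡ split j
    same-split = ×-≡,≡→≡ (trans (fibre-member colour ei) (sym (fibre-member colour ej)) , eq)

-- Colourings of K_{n,n} and copies in them

isRow : ∀ {n} → Fin n ⊎ Fin n → Bool
isRow (inj₁ _) = true
isRow (inj₂ _) = false

edge⇒opposite-sides : ∀ {n k} (c : Colouring n k) X Y → edgeCol c X Y ≢ nothing → isRow X ≢ isRow Y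
edge⇒opposite-sides c (inj₁ _) (inj₁ _) undefined = ⊥-elim (undefined refl)
edge⇒opposite-sides c (inj₂ _) (inj₂ _) undefined = ⊥-elim (undefined refl)
edge⇒opposite-sides c (inj₁ _) (inj₂ _) _ ()
edge⇒opposite-sides c (inj₂ _) (inj₁ _) _ ()

edge⇒row-endpoint : ∀ {n k} (c : Colouring n k) X Y → edgeCol c X Y ≢ nothing →
  isRow X ≡ true ⊎ isRow Y ≡ true
edge⇒row-endpoint c (inj₁ _) _ _ = inj₁ refl
edge⇒row-endpoint c (inj₂ _) (inj₁ _) _ = inj₂ refl
edge⇒row-endpoint c (inj₂ _) (inj₂ _) undefined = ⊥-elim (undefined refl)

same-side⇒reduce-injective : ∀ {n} {X Y : Fin n ⊎ Fin n} → isRow X ≡ isRow Y → reduce X ≡ reduce Y → X ≡ Y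
same-side⇒reduce-injective {X = inj₁ _} {inj₁ _} _ refl = refl
same-side⇒reduce-injective {X = inj₂ _} {inj₂ _} _ refl = refl

RowColouring : ∀ {n k} → Colouring n k → (Fin n → Fin k) → Set
RowColouring c g = ∀ i j → c i j ≡ g i

transpose : ∀ {n k} → Colouring n k → Colouring n k
transpose c i j = c j i

edgeCol-sym : ∀ {n k} (c : Colouring n k) X Y → edgeCol c X Y ≡ edgeCol c Y X
edgeCol-sym c (inj₁ _) (inj₁ _) = refl
edgeCol-sym c (inj₁ _) (inj₂ _) = refl
edgeCol-sym c (inj₂ _) (inj₁ _) = refl
edgeCol-sym c (inj₂ _) (inj₂ _) = refl

edgeCol-recolour : ∀ {n k k′} {d : Colouring n k} {c : Colouring n k′} (ψ : Fin k → Fin k′) →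
  (∀ i j → c i j ≡ ψ (d i j)) → ∀ X Y → edgeCol c X Y ≡ Maybe.map ψ (edgeCol d X Y)
edgeCol-recolour ψ c≡ψd (inj₁ i) (inj₂ j) = cong just (c≡ψd i j)
edgeCol-recolour ψ c≡ψd (inj₂ j) (inj₁ i) = cong just (c≡ψd i j)
edgeCol-recolour ψ c≡ψd (inj₁ _) (inj₁ _) = refl
edgeCol-recolour ψ c≡ψd (inj₂ _) (inj₂ _) = refl

monoCopy : ∀ {n k} H {c : Colouring n k} (f : Fin (size H) → Fin n ⊎ Fin n) → Injective _≡_ _≡_ f →
  (γ : Fin k) → (∀ {u v} → E H u v → edgeCol c (f u) (f v) ≡ just γ) → MonoCopy H c
monoCopy H f f-injective γ mono =
  f , (f-injective , λ e undefined → case trans (sym (mono e)) undefined of λ ()) , γ , mono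

monoCopy-recolour : ∀ {n k k′} H {d : Colouring n k} {c : Colouring n k′} (ψ : Fin k → Fin k′) →
  (∀ i j → c i j ≡ ψ (d i j)) → MonoCopy H d → MonoCopy H c
monoCopy-recolour H ψ c≡ψd (f , (f-injective , _) , γ , mono) =
  monoCopy H f f-injective (ψ γ) λ e → trans (edgeCol-recolour ψ c≡ψd _ _) (cong (Maybe.map ψ) (mono e))

rainbowCopy-uncolour : ∀ {n k k′} G {d : Colouring n k} {c : Colouring n k′} (ψ : Fin k → Fin k′) →
  (∀ i j → c i j ≡ ψ (d i j)) → RainbowCopy G c → RainbowCopy G d
rainbowCopy-uncolour G ψ c≡ψd (f , (f-injective , defined) , rainbow) =
  f , (f-injective , λ e → defined e ∘ λ undefined → trans (recolour _ _) (map-nothing undefined)) ,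
  λ e e′ eq → rainbow e e′ (trans (recolour _ _) (trans (cong (Maybe.map ψ) eq) (sym (recolour _ _))))
  where
  recolour = edgeCol-recolour ψ c≡ψd

monoCopy-transport : ∀ {m n k} H {c′ : Colouring m k} {c : Colouring n k}
  (φ : Fin m ⊎ Fin m → Fin n ⊎ Fin n) → Injective _≡_ _≡_ φ →
  (∀ X Y → edgeCol c (φ X) (φ Y) ≡ edgeCol c′ X Y) → MonoCopy H c′ → MonoCopy H c
monoCopy-transport H φ φ-injective φ-edgeCol (f , (f-injective , _) , γ , mono) =
  monoCopy H (φ ∘ f) (f-injective ∘ φ-injective) γ λ e → trans (φ-edgeCol _ _) (mono e)

monoCopy-transpose : ∀ {n k} H {c : Colouring n k} → MonoCopy H (transpose c) → MonoCopy H c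
monoCopy-transpose H {c} = monoCopy-transport H swap swap-injective swap-edgeCol
  where
  swap-injective : Injective _≡_ _≡_ swap
  swap-injective {X} {Y} eq = trans (sym (swap-involutive X)) (trans (cong swap eq) (swap-involutive Y))
  swap-edgeCol : ∀ X Y → edgeCol c (swap X) (swap Y) ≡ edgeCol (transpose c) X Y
  swap-edgeCol (inj₁ _) (inj₁ _) = refl
  swap-edgeCol (inj₁ _) (inj₂ _) = refl
  swap-edgeCol (inj₂ _) (inj₁ _) = refl
  swap-edgeCol (inj₂ _) (inj₂ _) = refl

BRProp-mono : ∀ {k} H {m n} → BRProp k H m → m ≤ n → BRProp k H n
BRProp-mono H {m} {n} BR m≤n c =
  monoCopy-transport H (Sum.map embed embed) map-injective map-edgeCol (BR (λ i j → c (embed i) (embed j)))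
  where
  embed : Fin m → Fin n
  embed i = inject≤ i m≤n
  map-injective : Injective _≡_ _≡_ (Sum.map embed embed)
  map-injective {inj₁ i} {inj₁ j} eq = cong inj₁ (inject≤-injective _ _ i j (inj₁-injective eq))
  map-injective {inj₂ i} {inj₂ j} eq = cong inj₂ (inject≤-injective _ _ i j (inj₂-injective eq))
  map-edgeCol : ∀ X Y →
    edgeCol c (Sum.map embed embed X) (Sum.map embed embed Y) ≡ edgeCol (λ i j → c (embed i) (embed j)) X Y
  map-edgeCol (inj₁ _) (inj₁ _) = refl
  map-edgeCol (inj₁ _) (inj₂ _) = refl
  map-edgeCol (inj₂ _) (inj₁ _) = refl
  map-edgeCol (inj₂ _) (inj₂ _) = refl

-- Bipartitions

∁-bipartition : ∀ H p → IsBipartition H p → IsBipartition H (∁ p)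
∁-bipartition H p bp {u} {v} e eq =
  bp e (not-injective (trans (sym (lookup-∁ p u)) (trans eq (lookup-∁ p v))))

IsS⇒≤side : ∀ H {s} → IsS H s → ∀ p → IsBipartition H p → s ≤ ∣ p ∣
IsS⇒≤side H (_ , minimal) p bp with ∣ p ∣ ≤? ∣ ∁ p ∣
... | yes p≤∁p = minimal p bp p≤∁p
... | no p≰∁p = ≤-trans (minimal (∁ p) (∁-bipartition H p bp) ∁p≤∁∁p) (<⇒≤ ∁p<p)
  where
  ∁p<p = ≰⇒> p≰∁p
  ∁p≤∁∁p : ∣ ∁ p ∣ ≤ ∣ ∁ (∁ p) ∣
  ∁p≤∁∁p = subst (λ q → ∣ ∁ p ∣ ≤ ∣ q ∣) (sym (∁-involutive p)) (<⇒≤ ∁p<p)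

IsS-positive : ∀ H {s} → HasEdge H → IsS H s → 0 < s
IsS-positive H (u , v , e) ((p , bp , _ , refl) , _) with lookup p u in pu | lookup p v in pv
... | true | _ = ≤-<-trans z≤n (toℕ<n (rank p u pu))
... | false | true = ≤-<-trans z≤n (toℕ<n (rank p v pv))
... | false | false = ⊥-elim (bp e (trans pu (sym pv)))

xor-flip : ∀ {a a′ b b′} → a ≢ a′ → b ≢ b′ → a xor b ≡ a′ xor b′
xor-flip {a′ = a′} {b′ = b′} a≢a′ b≢b′ =
  trans (cong₂ _xor_ (¬-not a≢a′) (¬-not b≢b′)) (not-xor-not a′ b′)
  where
  not-xor-not : ∀ x y → not x xor not y ≡ x xor y
  not-xor-not true y = refl
  not-xor-not false y = not-involutive y

-- A copy of a connected graph puts each side of a bipartition entirely on one side of K_{n,n}.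
connected-copy⇒∣∁p∣≤n : ∀ {n k} H {c : Colouring n k} {f} → Connected H →
  ∀ p → IsBipartition H p → IsCopy H c f → ∣ ∁ p ∣ ≤ n
connected-copy⇒∣∁p∣≤n H {c} {f} connected p bp (f-injective , defined) =
  injection⇒∣p∣≤ (∁ p) (λ v _ → reduce (f v)) λ ev ev′ eq →
    f-injective (same-side⇒reduce-injective (same-side ev ev′) eq)
  where
  parity : Fin (size H) → Bool
  parity u = lookup p u xor isRow (f u)
  parity-invariant : ∀ {u v} → Reach H u v → parity u ≡ parity v
  parity-invariant here = refl
  parity-invariant (step e r) =
    trans (xor-flip (bp e) (edge⇒opposite-sides c _ _ (defined e))) (parity-invariant r)
  side : ∀ {v} → lookup (∁ p) v ≡ true → parity v ≡ isRow (f v)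
  side {v} ev = cong (_xor isRow (f v)) (not-injective (trans (sym (lookup-∁ p v)) ev))
  same-side : ∀ {v v′} → lookup (∁ p) v ≡ true → lookup (∁ p) v′ ≡ true → isRow (f v) ≡ isRow (f v′)
  same-side ev ev′ = trans (sym (side ev)) (trans (parity-invariant (connected _ _)) (side ev′))

-- Rainbow copies of P4

P4-step : (i : Fin 3) → E P4 (inject₁ i) (suc i)
P4-step i = inj₁ (cong suc (toℕ-inject₁ i))

≢nothing⇒≡just : ∀ {A : Set} (m : Maybe A) → m ≢ nothing → ∃ λ a → m ≡ just a
≢nothing⇒≡just (just a) _ = a , refl
≢nothing⇒≡just nothing undefined = ⊥-elim (undefined refl)

rainbowP4⇒3≤k : ∀ {n k} {c : Colouring n k} → RainbowCopy P4 c → 3 ≤ k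
rainbowP4⇒3≤k {k = k} {c} (f , (_ , defined) , rainbow) = injective⇒≤ {f = colour} colour-injective
  where
  step-colour : ∀ i → ∃ λ γ → edgeCol c (f (inject₁ i)) (f (suc i)) ≡ just γ
  step-colour i = ≢nothing⇒≡just _ (defined (P4-step i))
  colour : Fin 3 → Fin k
  colour = proj₁ ∘ step-colour
  colour-injective : Injective _≡_ _≡_ colour
  colour-injective {i} {j} eq
    with rainbow (P4-step i) (P4-step j)
                 (trans (proj₂ (step-colour i)) (trans (cong just eq) (sym (proj₂ (step-colour j)))))
  ... | inj₁ (i≡j , _) = inject₁-injective i≡j
  ... | inj₂ (i≡1+j , 1+i≡j) = ⊥-elim (<-asym
    (≤-reflexive (trans (sym (cong toℕ i≡1+j)) (toℕ-inject₁ i)))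
    (≤-reflexive (trans (cong toℕ 1+i≡j) (toℕ-inject₁ j))))

position : ∀ {u v} → E P4 u v → ℕ
position {u} (inj₁ _) = toℕ u
position {v = v} (inj₂ _) = toℕ v

position<3 : ∀ {u v} (e : E P4 u v) → position e < 3
position<3 {v = v} (inj₁ e) = ≤-pred (subst (_< 4) (sym e) (toℕ<n v))
position<3 {u} (inj₂ e) = ≤-pred (subst (_< 4) (sym e) (toℕ<n u))

same-position⇒same-edge : ∀ {u v u′ v′} (e : E P4 u v) (e′ : E P4 u′ v′) → position e ≡ position e′ →
  (u ≡ u′ × v ≡ v′) ⊎ (u ≡ v′ × v ≡ u′)
same-position⇒same-edge (inj₁ e) (inj₁ e′) p =
  inj₁ (toℕ-injective p , toℕ-injective (trans (sym e) (trans (cong suc p) e′)))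
same-position⇒same-edge (inj₁ e) (inj₂ e′) p =
  inj₂ (toℕ-injective p , toℕ-injective (trans (sym e) (trans (cong suc p) e′)))
same-position⇒same-edge (inj₂ e) (inj₁ e′) p =
  inj₂ (toℕ-injective (trans (sym e) (trans (cong suc p) e′)) , toℕ-injective p)
same-position⇒same-edge (inj₂ e) (inj₂ e′) p =
  inj₁ (toℕ-injective (trans (sym e) (trans (cong suc p) e′)) , toℕ-injective p)

rainbowPath : ∀ {n k} (c : Colouring n k) {u₁ v₁ u₂ v₂} →
  c u₁ v₁ ≢ c u₂ v₁ → c u₂ v₁ ≢ c u₂ v₂ → c u₁ v₁ ≢ c u₂ v₂ → RainbowCopy P4 c
rainbowPath {n} {k} c {u₁} {v₁} {u₂} {v₂} d₀₁ d₁₂ d₀₂ =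
  path ∘ toℕ , (path-injective , defined) , rainbow
  where
  path : ℕ → Fin n ⊎ Fin n
  path 0 = inj₁ u₁
  path 1 = inj₂ v₁
  path 2 = inj₁ u₂
  path _ = inj₂ v₂

  back : Fin n ⊎ Fin n → Fin 4
  back (inj₁ u) = if does (u ≟ u₁) then 0F else 2F
  back (inj₂ v) = if does (v ≟ v₁) then 1F else 3F

  back-path : ∀ i → back (path (toℕ i)) ≡ i
  back-path 0F = cong (if_then 0F else 2F) (dec-true (u₁ ≟ u₁) refl)
  back-path 1F = cong (if_then 1F else 3F) (dec-true (v₁ ≟ v₁) refl)
  back-path 2F = cong (if_then 0F else 2F) (dec-false (u₂ ≟ u₁) λ e → d₀₁ (cong (λ u → c u v₁) (sym e)))
  back-path 3F = cong (if_then 1F else 3F) (dec-false (v₂ ≟ v₁) λ e → d₁₂ (cong (c u₂) (sym e)))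

  path-injective : Injective _≡_ _≡_ (path ∘ toℕ)
  path-injective {i} {j} eq = trans (sym (back-path i)) (trans (cong back eq) (back-path j))

  colour : ℕ → Maybe (Fin k)
  colour i = edgeCol c (path i) (path (suc i))

  colour-position : ∀ {u v} (e : E P4 u v) → edgeCol c (path (toℕ u)) (path (toℕ v)) ≡ colour (position e)
  colour-position {u} (inj₁ e) = cong (edgeCol c (path (toℕ u)) ∘ path) (sym e)
  colour-position {v = v} (inj₂ e) =
    trans (edgeCol-sym c _ _) (cong (edgeCol c (path (toℕ v)) ∘ path) (sym e))

  colour-defined : ∀ {i} → i < 3 → colour i ≢ nothing
  colour-defined {0} _ ()
  colour-defined {1} _ ()
  colour-defined {2} _ ()
  colour-defined {suc (suc (suc _))} (s≤s (s≤s (s≤s ())))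

  colour-injective : ∀ {i j} → i < 3 → j < 3 → colour i ≡ colour j → i ≡ j
  colour-injective {0} {0} _ _ _ = refl
  colour-injective {1} {1} _ _ _ = refl
  colour-injective {2} {2} _ _ _ = refl
  colour-injective {0} {1} _ _ eq = ⊥-elim (d₀₁ (just-injective eq))
  colour-injective {1} {0} _ _ eq = ⊥-elim (d₀₁ (sym (just-injective eq)))
  colour-injective {1} {2} _ _ eq = ⊥-elim (d₁₂ (just-injective eq))
  colour-injective {2} {1} _ _ eq = ⊥-elim (d₁₂ (sym (just-injective eq)))
  colour-injective {0} {2} _ _ eq = ⊥-elim (d₀₂ (just-injective eq))
  colour-injective {2} {0} _ _ eq = ⊥-elim (d₀₂ (sym (just-injective eq)))
  colour-injective {suc (suc (suc _))} (s≤s (s≤s (s≤s ())))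
  colour-injective {j = suc (suc (suc _))} _ (s≤s (s≤s (s≤s ())))

  defined : ∀ {u v} → E P4 u v → edgeCol c (path (toℕ u)) (path (toℕ v)) ≢ nothing
  defined e = colour-defined (position<3 e) ∘ trans (sym (colour-position e))

  rainbow : ∀ {u v u′ v′} → E P4 u v → E P4 u′ v′ →
    edgeCol c (path (toℕ u)) (path (toℕ v)) ≡ edgeCol c (path (toℕ u′)) (path (toℕ v′)) →
    (u ≡ u′ × v ≡ v′) ⊎ (u ≡ v′ × v ≡ u′)
  rainbow e e′ eq = same-position⇒same-edge e e′ (colour-injective (position<3 e) (position<3 e′)
    (trans (sym (colour-position e)) (trans eq (colour-position e′))))

-- Rows u, columns v; the colour conditions already force u₁ ≢ u₂ and v₁ ≢ v₂.
NoRainbowPath : ∀ {n k} → Colouring n k → Set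
NoRainbowPath c = ∀ u₁ v₁ u₂ v₂ → c u₁ v₁ ≢ c u₂ v₁ → c u₂ v₁ ≢ c u₂ v₂ → c u₁ v₁ ≡ c u₂ v₂

rainbowCopy⊎noRainbowPath : ∀ {n k} (c : Colouring n k) → RainbowCopy P4 c ⊎ NoRainbowPath c
rainbowCopy⊎noRainbowPath c
  with any? (λ u₁ → any? λ v₁ → any? λ u₂ → any? λ v₂ →
         ¬? (c u₁ v₁ ≟ c u₂ v₁) ×-dec ¬? (c u₂ v₁ ≟ c u₂ v₂) ×-dec ¬? (c u₁ v₁ ≟ c u₂ v₂))
... | yes (_ , _ , _ , _ , d₀₁ , d₁₂ , d₀₂) = inj₁ (rainbowPath c d₀₁ d₁₂ d₀₂)
... | no none = inj₂ λ u₁ v₁ u₂ v₂ d₀₁ d₁₂ →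
  decidable-stable (c u₁ v₁ ≟ c u₂ v₂) λ d₀₂ → none (u₁ , v₁ , u₂ , v₂ , d₀₁ , d₁₂ , d₀₂)

-- Row colourings

rowColouring-star : ∀ {n k} {c : Colouring n k} {g} → RowColouring c g → ∀ {X Y Z} → isRow Y ≡ true →
  edgeCol c X Y ≢ nothing → edgeCol c Y Z ≢ nothing → edgeCol c X Y ≡ edgeCol c Y Z
rowColouring-star rows {Y = inj₂ _} ()
rowColouring-star rows {inj₁ _} {inj₁ _} _ undefined _ = ⊥-elim (undefined refl)
rowColouring-star rows {inj₂ _} {inj₁ _} {inj₁ _} _ _ undefined = ⊥-elim (undefined refl)
rowColouring-star rows {inj₂ j} {inj₁ i} {inj₂ j′} _ _ _ = cong just (trans (rows i j) (sym (rows i j′)))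

-- One of the two middle vertices of a P4 is a row, and both edges at a row have the same colour.
rowColouring-noRainbowP4 : ∀ {n k} {c : Colouring n k} {g} → RowColouring c g → ¬ RainbowCopy P4 c
rowColouring-noRainbowP4 {c = c} rows (f , (_ , defined) , rainbow)
  with edge⇒row-endpoint c _ _ (defined (P4-step 1F))
... | inj₁ row₁
  with rainbow (P4-step 0F) (P4-step 1F)
               (rowColouring-star rows row₁ (defined (P4-step 0F)) (defined (P4-step 1F)))
...   | inj₁ (() , _)
...   | inj₂ (() , _)
rowColouring-noRainbowP4 {c = c} rows (f , (_ , defined) , rainbow) | inj₂ row₂
  with rainbow (P4-step 1F) (P4-step 2F)
               (rowColouring-star rows row₂ (defined (P4-step 1F)) (defined (P4-step 2F)))
...   | inj₁ (() , _)
...   | inj₂ (() , _)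

rowColouring-monoCopy : ∀ {n k} H {γ} {c : Colouring n k} {g} → RowColouring c g → ∀ p → IsBipartition H p →
  ∣ p ∣ ≤ ∣ fibre g γ ∣ → ∣ ∁ p ∣ ≤ n → MonoCopy H c
rowColouring-monoCopy {n} {k} H {γ} {c} {g} rows p bp p≤A ∁p≤n =
  monoCopy H embed (place-injective refl refl) γ λ e → place-mono refl refl (bp e)
  where
  A = fibre g γ
  place : ∀ u b → lookup p u ≡ b → Fin n ⊎ Fin n
  place u true e = inj₁ (select A (inject≤ (rank p u e) p≤A))
  place u false e = inj₂ (inject≤ (rank (∁ p) u (trans (lookup-∁ p u) (cong not e))) ∁p≤n)
  embed : Fin (size H) → Fin n ⊎ Fin n
  embed u = place u (lookup p u) refl
  place-injective : ∀ {u v b b′} (e : lookup p u ≡ b) (e′ : lookup p v ≡ b′) →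
    place u b e ≡ place v b′ e′ → u ≡ v
  place-injective {b = true} {true} _ _ eq =
    rank-injective p (inject≤-injective _ _ _ _ (select-injective A (inj₁-injective eq)))
  place-injective {b = false} {false} _ _ eq =
    rank-injective (∁ p) (inject≤-injective _ _ _ _ (inj₂-injective eq))
  row-colour : ∀ i j → lookup A i ≡ true → c i j ≡ γ
  row-colour i j i∈A = trans (rows i j) (fibre-member g i∈A)
  place-mono : ∀ {u v b b′} (e : lookup p u ≡ b) (e′ : lookup p v ≡ b′) → b ≢ b′ →
    edgeCol c (place u b e) (place v b′ e′) ≡ just γ
  place-mono {b = true} {false} _ _ _ = cong just (row-colour _ _ (select-member A _))
  place-mono {b = false} {true} _ _ _ = cong just (row-colour _ _ (select-member A _))
  place-mono {b = true} {true} _ _ b≢b = ⊥-elim (b≢b refl)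
  place-mono {b = false} {false} _ _ b≢b = ⊥-elim (b≢b refl)

-- The vertices of a monochromatic copy that land in rows of its colour form a side of a bipartition.
rowColouring-noMonoCopy : ∀ {n k} H {s} {c : Colouring n k} {g} → IsS H s → (∀ γ → ∣ fibre g γ ∣ < s) →
  RowColouring c g → ¬ MonoCopy H c
rowColouring-noMonoCopy {n} {k} H {s} {c} {g} isS small rows (f , (f-injective , _) , γ , mono) =
  <⇒≱ (small γ) (≤-trans (IsS⇒≤side H isS p bipartition) p≤A)
  where
  A = fibre g γ
  inA : Fin n ⊎ Fin n → Bool
  inA (inj₁ i) = lookup A i
  inA (inj₂ _) = false
  p : Subset (size H)
  p = tabulate (inA ∘ f)
  lookup-p : ∀ u → lookup p u ≡ inA (f u)
  lookup-p = lookup∘tabulate (inA ∘ f)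
  row∈A : ∀ {i j} → edgeCol c (inj₁ i) (inj₂ j) ≡ just γ → lookup A i ≡ true
  row∈A {i} {j} eq = ∈fibre g (trans (sym (rows i j)) (just-injective eq))
  separates : ∀ X Y → edgeCol c X Y ≡ just γ → inA X ≢ inA Y
  separates (inj₁ i) (inj₂ j) eq i∉A = case trans (sym (row∈A eq)) i∉A of λ ()
  separates (inj₂ j) (inj₁ i) eq i∉A = case trans i∉A (row∈A eq) of λ ()
  bipartition : IsBipartition H p
  bipartition {u} {v} e eq = separates (f u) (f v) (mono e) (trans (sym (lookup-p u)) (trans eq (lookup-p v)))
  rankA : ∀ X → inA X ≡ true → Fin ∣ A ∣
  rankA (inj₁ i) i∈A = rank A i i∈A
  rankA-injective : ∀ {X Y} eX eY → rankA X eX ≡ rankA Y eY → X ≡ Y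
  rankA-injective {inj₁ _} {inj₁ _} _ _ eq = cong inj₁ (rank-injective A eq)
  p≤A : ∣ p ∣ ≤ ∣ A ∣
  p≤A = injection⇒∣p∣≤ p (λ u u∈p → rankA (f u) (trans (sym (lookup-p u)) u∈p))
    λ _ _ eq → f-injective (rankA-injective _ _ eq)

-- Colourings without a rainbow P4

module NoRainbowPathProperties {n k} (c : Colouring n k) (noPath : NoRainbowPath c) where

  -- A path b-x-a-z would force c b x = c a z, and then a path a-x-b-w would force c a x = c b w.
  row-agrees : ∀ {a b x z w} → c a x ≢ c a z → c b w ≢ c a x → c b w ≢ c a z → c b x ≡ c a x
  row-agrees {a} {b} {x} {z} {w} ax≢az bw≢ax bw≢az = decidable-stable (c b x ≟ c a x) λ bx≢ax →
    let bx≡az = noPath b x a z bx≢ax ax≢az in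
    bw≢ax (sym (noPath a x b w (λ ax≡bx → ax≢az (trans ax≡bx bx≡az))
                               (λ bx≡bw → bw≢az (trans (sym bx≡bw) bx≡az))))

  -- If c b′ w ≠ c b w, the path b′-w-b-y forces c b′ w = c b y for every y with c b y ≠ c b w,
  -- and at least two of the three colours of row b qualify.
  trichromatic⇒columns-constant : ∀ {b x y z} → c b x ≢ c b y → c b y ≢ c b z → c b x ≢ c b z →
    ∀ b′ w → c b′ w ≡ c b w
  trichromatic⇒columns-constant {b} {x} {y} {z} xy yz xz b′ w = decidable-stable (c b′ w ≟ c b w) differs
    where
    forced : c b′ w ≢ c b w → ∀ {y′} → c b w ≢ c b y′ → c b′ w ≡ c b y′
    forced b′w≢bw = noPath b′ w b _ b′w≢bw
    differs : c b′ w ≢ c b w → ⊥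
    differs b′w≢bw with c b w ≟ c b x | c b w ≟ c b y
    ... | yes wx | _ =
      yz (trans (sym (forced b′w≢bw (xy ∘ trans (sym wx)))) (forced b′w≢bw (xz ∘ trans (sym wx))))
    ... | no wx | yes wy = xz (trans (sym (forced b′w≢bw wx)) (forced b′w≢bw (yz ∘ trans (sym wy))))
    ... | no wx | no wy = xy (trans (sym (forced b′w≢bw wx)) (forced b′w≢bw wy))

  two-colours : ∀ {a x z} → c a x ≢ c a z → ¬ RowColouring (transpose c) (c z) →
    ∀ i j → c i j ≡ c a x ⊎ c i j ≡ c a z
  two-colours {a} {x} {z} ax≢az not-columns i j with c i j ≟ c a x | c i j ≟ c a z
  ... | yes ij≡ax | _ = inj₁ ij≡ax
  ... | no _ | yes ij≡az = inj₂ ij≡az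
  ... | no ij≢ax | no ij≢az = ⊥-elim (not-columns λ w b → trans (columns b w) (sym (columns z w)))
    where
    ix≡ax = row-agrees ax≢az ij≢ax ij≢az
    iz≡az = row-agrees (ax≢az ∘ sym) ij≢az ij≢ax
    columns = trichromatic⇒columns-constant {i} {x} {z} {j}
      (λ ix≡iz → ax≢az (trans (sym ix≡ax) (trans ix≡iz iz≡az)))
      (λ iz≡ij → ij≢az (trans (sym iz≡ij) iz≡az))
      (λ ix≡ij → ij≢ax (trans (sym ix≡ij) ix≡ax))

  structure : (z : Fin n) → RowColouring c (λ a → c a z) ⊎ RowColouring (transpose c) (c z) ⊎
                            ∃₂ λ α β → ∀ i j → c i j ≡ α ⊎ c i j ≡ β
  structure z with all? (λ a → all? λ x → c a x ≟ c a z) | all? (λ w → all? λ b → c b w ≟ c z w)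
  ... | yes rows | _ = inj₁ rows
  ... | no _ | yes columns = inj₂ (inj₁ columns)
  ... | no not-rows | no not-columns with ¬∀⟶∃¬ n _ (λ a → all? λ x → c a x ≟ c a z) not-rows
  ...   | a , not-row-a with ¬∀⟶∃¬ n _ (λ x → c a x ≟ c a z) not-row-a
  ...     | x , ax≢az = inj₂ (inj₂ (c a x , c a z , two-colours ax≢az not-columns))

two-valued⇒factors : ∀ {n k} {c : Colouring n k} {α β} → (∀ i j → c i j ≡ α ⊎ c i j ≡ β) →
  ∃ λ (d : Colouring n 2) → ∀ i j → c i j ≡ lookup (α ∷ β ∷ []) (d i j)
two-valued⇒factors {α = α} {β} two = (λ i j → index (two i j)) , λ i j → factor (two i j)
  where
  index : ∀ {γ} → γ ≡ α ⊎ γ ≡ β → Fin 2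
  index (inj₁ _) = 0F
  index (inj₂ _) = 1F
  factor : ∀ {γ} (e : γ ≡ α ⊎ γ ≡ β) → γ ≡ lookup (α ∷ β ∷ []) (index e)
  factor (inj₁ e) = e
  factor (inj₂ e) = e

BRProp₂⇒hProp : ∀ H {k n} → BRProp 2 H n →
  ∀ p → IsBipartition H p → k * (∣ p ∣ ∸ 1) < n → ∣ ∁ p ∣ ≤ n → hProp k H P4 n
BRProp₂⇒hProp H {k} {n} BR p bp k[p-1]<n ∁p≤n c =
  [ inj₂ , inj₁ ∘ noRainbowPath⇒monoCopy ]′ (rainbowCopy⊎noRainbowPath c)
  where
  column : Fin n
  column = fromℕ< (≤-<-trans z≤n k[p-1]<n)
  rowwise : ∀ {c′ g} → RowColouring c′ g → MonoCopy H c′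
  rowwise {g = g} rows with pigeonhole-fibre (∣ p ∣ ∸ 1) g k[p-1]<n
  ... | γ , p-1<A = rowColouring-monoCopy H rows p bp (≤-trans (m≤n+m∸n ∣ p ∣ 1) p-1<A) ∁p≤n
  noRainbowPath⇒monoCopy : NoRainbowPath c → MonoCopy H c
  noRainbowPath⇒monoCopy noPath with NoRainbowPathProperties.structure c noPath column
  ... | inj₁ rows = rowwise rows
  ... | inj₂ (inj₁ columns) = monoCopy-transpose H (rowwise columns)
  ... | inj₂ (inj₂ (α , β , two)) with two-valued⇒factors two
  ...   | d , c≡αβ∘d = monoCopy-recolour H (lookup (α ∷ β ∷ [])) c≡αβ∘d (BR d)

hProp⇒BRProp₂ : ∀ H {k m} → 3 ≤ k → hProp k H P4 m → BRProp 2 H m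
hProp⇒BRProp₂ H {suc (suc (suc k′))} (s≤s (s≤s (s≤s _))) h d =
  [ monoCopy-recolour H collapse (λ i j → collapse∘embed (d i j)) , ⊥-elim ∘ no-rainbow ]′
    (h (λ i j → embed (d i j)))
  where
  embed : Fin 2 → Fin (3 + k′)
  embed 0F = 0F
  embed 1F = 1F
  collapse : Fin (3 + k′) → Fin 2
  collapse 0F = 0F
  collapse (suc _) = 1F
  collapse∘embed : ∀ b → b ≡ collapse (embed b)
  collapse∘embed 0F = refl
  collapse∘embed 1F = refl
  no-rainbow : ¬ RainbowCopy P4 (λ i j → embed (d i j))
  no-rainbow rainbow with rainbowP4⇒3≤k (rainbowCopy-uncolour P4 embed (λ _ _ → refl) rainbow)
  ... | s≤s (s≤s ())

hProp⇒k[s-1]<m : ∀ H {k s m} → HasEdge H → IsS H s → hProp k H P4 m → k * (s ∸ 1) < m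
hProp⇒k[s-1]<m H {k} {s} {m} edge isS h with m ≤? k * (s ∸ 1) | IsS-positive H edge isS
... | no m≰k[s-1] | _ = ≰⇒> m≰k[s-1]
... | yes m≤k[s-1] | s≤s _ with balanced-colouring m≤k[s-1]
...   | g , balanced with h (λ i _ → g i)
...     | inj₁ mono = ⊥-elim (rowColouring-noMonoCopy H isS (s≤s ∘ balanced) (λ _ _ → refl) mono)
...     | inj₂ rainbow = ⊥-elim (rowColouring-noRainbowP4 (λ _ _ → refl) rainbow)

-- Bipartiteness of H is already witnessed by the bipartition realising s(H).
proposition6p6 : (H : Graph) → IsBipartite H → HasEdge H →
    (k : ℕ) → 3 ≤ k →
    (s t br : ℕ) → IsS H s → IsT H t → Least (BRProp 2 H) br →
    (Connected H ⊎ t ∸ 1 ≤ k * (s ∸ 1)) →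
    Least (hProp k H P4) (br ⊔ (k * (s ∸ 1) + 1))
proposition6p6 H _ edge k 3≤k _ t br isS@((p , bp , p≤∁p , refl) , _) (_ , t-maximal) (BR , br-least)
               side-bound =
  BRProp₂⇒hProp H (BRProp-mono H BR (m≤m⊔n br _)) p bp k[s-1]<N ∁p≤N , lower
  where
  N = br ⊔ (k * (∣ p ∣ ∸ 1) + 1)
  k[s-1]<N : k * (∣ p ∣ ∸ 1) < N
  k[s-1]<N = subst (_≤ N) (+-comm _ 1) (m≤n⊔m br _)
  ∁p≤N : ∣ ∁ p ∣ ≤ N
  ∁p≤N = [ connected⇒∁p≤N , t-small⇒∁p≤N ]′ side-bound
    where
    connected⇒∁p≤N : Connected H → ∣ ∁ p ∣ ≤ N
    connected⇒∁p≤N connected =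
      ≤-trans (connected-copy⇒∣∁p∣≤n H connected p bp (proj₁ (proj₂ (BR λ _ _ → 0F)))) (m≤m⊔n br _)
    t-small⇒∁p≤N : t ∸ 1 ≤ k * (∣ p ∣ ∸ 1) → ∣ ∁ p ∣ ≤ N
    t-small⇒∁p≤N t∸1≤k[s-1] = begin
      ∣ ∁ p ∣              ≤⟨ t-maximal p bp p≤∁p ⟩
      t                    ≤⟨ m≤n+m∸n t 1 ⟩
      1 + (t ∸ 1)          ≤⟨ +-monoʳ-≤ 1 t∸1≤k[s-1] ⟩
      1 + k * (∣ p ∣ ∸ 1)  ≡⟨ +-comm 1 _ ⟩
      k * (∣ p ∣ ∸ 1) + 1  ≤⟨ m≤n⊔m br _ ⟩
      N                    ∎
      where open ≤-Reasoning
  lower : ∀ m → hProp k H P4 m → N ≤ m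
  lower m h =
    ⊔-lub (br-least m (hProp⇒BRProp₂ H 3≤k h)) (subst (_≤ m) (+-comm 1 _) (hProp⇒k[s-1]<m H edge isS h))
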